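{- Let $S_1=K_1$ and, for $n\ge 2$, let $S_n=s(S_{n-1})$. Let $\Gamma$ be the class of all graphs isomorphic to an induced subgraph of some $S_n$, $n\ge 1$. Then $\Gamma$ has unbounded $\alpha$-pathwidth, i.e., for every integer $c$ there is a graph $G\in\Gamma$ with $\alpha\text{ - }\mathrm{pw}(G)>c$.
   Context: All graphs are finite, simple and undirected; $\alpha(G)$ is the independence number. A path decomposition of $G$ is a pair $(P,\beta)$ where $P$ is a path and $\beta$ assigns to each node $x$ of $P$ a bag $\beta(x)\subseteq V(G)$ such that every vertex lies in some bag, both endpoints of every edge lie in a common bag, and for every vertex $v$ the nodes whose bags contain $v$ form a subpath of $P$. The $\alpha$-pathwidth $\alpha\text{ - }\mathrm{pw}(G)$ is the minimum over all path decompositions of $\max_x \alpha(G[\beta(x)])$. The s-claw substitution $s(G)$ of $G$ is obtained from the disjoint union of three copies $G_1,G_2,G_3$ of $G$ by adding new vertices $v_1,v_2,v_3$ with each $v_i$ adjacent to all vertices of $G_i$, and a new vertex $w$ adjacent precisely to $v_1,v_2,v_3$. -}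

module Defs where

open import Data.Nat using (ℕ; zero; suc; _≤_)
open import Data.Fin using (Fin)
open import Data.Fin.Subset using (Subset; _∈_; _⊆_; ∣_∣)
open import Data.Product using (Σ; ∃; _×_; _,_)
open import Data.Unit using (⊤)
open import Data.Empty using (⊥)
open import Relation.Binary.PropositionalEquality using (_≡_)
open import Relation.Nullary using (¬_)
open import Function.Bundles using (_⇔_)

record Graph : Set₁ where
  field
    size   : ℕ
    Adj    : Fin size → Fin size → Set
    sym    : ∀ {x y} → Adj x y → Adj y x
    irrefl : ∀ {x} → ¬ Adj x x
open Graph public

Independent : (G : Graph) → Subset (size G) → Set
Independent G I = ∀ x y → x ∈ I → y ∈ I → ¬ Adj G x y

αInduced≤ : (G : Graph) → Subset (size G) → ℕ → Set
αInduced≤ G B c = ∀ (I : Subset (size G)) → I ⊆ B → Independent G I → ∣ I ∣ ≤ c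

-- Path decompositions: the path has nodes 0,1,…,ℓ (as Fin (suc ℓ)),
-- consecutive nodes adjacent.

record PathDecomposition (G : Graph) : Set where
  field
    len      : ℕ
    bag      : Fin (suc len) → Subset (size G)
    covers   : ∀ v → ∃ λ i → v ∈ bag i
    edges    : ∀ u v → Adj G u v → ∃ λ i → (u ∈ bag i) × (v ∈ bag i)
    interval : ∀ v (i j k : Fin (suc len)) →
               Data.Fin._≤_ i j → Data.Fin._≤_ j k →
               v ∈ bag i → v ∈ bag k → v ∈ bag j
open PathDecomposition public

αpw≤ : Graph → ℕ → Set
αpw≤ G c = Σ (PathDecomposition G) λ P → ∀ i → αInduced≤ G (bag P i) c

-- The graphs S_n (n ≥ 1). SV n is the vertex type of S_n;
-- SV 0 is empty and not used.

data SV : ℕ → Set where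
  root : SV 1
  cp   : ∀ {n} → Fin 3 → SV (suc n) → SV (suc (suc n))
  hub  : ∀ {n} → Fin 3 → SV (suc (suc n))
  top  : ∀ {n} → SV (suc (suc n))

SAdj : ∀ {n} → SV n → SV n → Set
SAdj root    root    = ⊥
SAdj (cp i x) (cp j y) = (i ≡ j) × SAdj x y
SAdj (cp i x) (hub j)  = i ≡ j
SAdj (cp i x) top      = ⊥
SAdj (hub i) (cp j y)  = i ≡ j
SAdj (hub i) (hub j)   = ⊥
SAdj (hub i) top       = ⊤
SAdj top     (cp j y)  = ⊥
SAdj top     (hub j)   = ⊤
SAdj top     top       = ⊥

InducedSubgraphOfS : Graph → ℕ → Set
InducedSubgraphOfS G n =
  Σ (Fin (size G) → SV n) λ f →
    (∀ x y → f x ≡ f y → x ≡ y) ×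
    (∀ x y → Adj G x y ⇔ SAdj (f x) (f y))

InΓ : Graph → Set
InΓ G = ∃ λ n → (1 ≤ n) × InducedSubgraphOfS G n

module Submission where

-- Every path decomposition of S_{m+1} has a bag containing m+1 pairwise non-adjacent
-- vertices. For the induction step, take such bags for the three copies of S_m and let
-- copy j be the one whose bag lies between the other two along the path. The path
-- u – v_i – w – v_l – u' from the outer copies i and l avoids copy j and all its
-- neighbours, and a walk between two bags meets every bag in between; so copy j's bag
-- contains a further vertex non-adjacent to all of copy j. Hence α-pw(S_{c+1}) > c.

open import Defs
open import Data.Nat as ℕ using (ℕ; zero; suc; _+_; _*_; z≤n; s≤s)
open import Data.Nat.Properties using (≤-trans; ≤-reflexive; n≮n)
open import Data.Fin as Fin using (Fin; zero; suc)
open import Data.Fin.Patterns using (0F; 1F; 2F)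
open import Data.Fin.Properties using (+↔⊎; *↔×; ≤-total)
open import Data.Fin.Subset using (Subset; _∈_; _∉_; _⊆_; ⁅_⁆; _∪_; ∣_∣)
open import Data.Fin.Subset.Properties
  using (∉⊥; x∈⁅x⁆; x∈⁅y⁆⇒x≡y; x∈p∪q⁻; x∈p∪q⁺; q⊆p∪q; p⊂q⇒∣p∣<∣q∣)
import Data.Fin.Subset as Subset
open import Data.List using (List; []; _∷_; length; map)
open import Data.List.Properties using (length-map)
open import Data.List.Membership.Propositional using () renaming (_∈_ to _∈ₗ_)
open import Data.List.Relation.Unary.All as All using (All; []; _∷_)
import Data.List.Relation.Unary.All.Properties as All
open import Data.List.Relation.Unary.Any using (here; there)
open import Data.List.Relation.Unary.AllPairs as AllPairs using (AllPairs; []; _∷_)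
import Data.List.Relation.Unary.AllPairs.Properties as AllPairs
open import Data.List.Relation.Unary.Unique.Propositional using (Unique)
open import Data.Product using (Σ; _×_; ∃; ∃-syntax; _,_; proj₁; proj₂)
open import Data.Product.Function.NonDependent.Propositional using (_×-cong_)
open import Data.Sum using (_⊎_; inj₁; inj₂)
open import Data.Sum.Function.Propositional using (_⊎-cong_)
open import Data.Unit using (tt)
open import Data.Empty using (⊥-elim)
open import Function using (_∘_; id)
open import Function.Bundles using (_↔_; Inverse; Injection; mk↔ₛ′; mk⇔)
open import Function.Properties.Inverse using (↔-refl; ↔-sym; ↔-trans; ↔⇒↣)
open import Level using (Level)
open import Relation.Binary.Core using (Rel)
open import Relation.Binary.Definitions using (Total)
open import Relation.Nullary using (¬_)
open import Relation.Binary.PropositionalEquality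
  using (_≡_; _≢_; refl; trans; cong; subst₂)
import Relation.Binary.PropositionalEquality as ≡

private
  variable
    ℓ : Level
    V W : Set

SAdj-sym : ∀ {n} {x y : SV n} → SAdj x y → SAdj y x
SAdj-sym {x = root}   {root}   ()
SAdj-sym {x = cp i x} {cp j y} (i≡j , x~y) = ≡.sym i≡j , SAdj-sym x~y
SAdj-sym {x = cp i x} {hub j}  i≡j = ≡.sym i≡j
SAdj-sym {x = hub i}  {cp j y} i≡j = ≡.sym i≡j
SAdj-sym {x = hub i}  {top}    tt  = tt
SAdj-sym {x = top}    {hub j}  tt  = tt

SAdj-irrefl : ∀ {n} {x : SV n} → ¬ SAdj x x
SAdj-irrefl {x = root}   ()
SAdj-irrefl {x = cp i x} (_ , x~x) = SAdj-irrefl x~x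

∣S∣ : ℕ → ℕ
∣S∣ zero          = 0
∣S∣ (suc zero)    = 1
∣S∣ (suc (suc n)) = 3 * ∣S∣ (suc n) + 4

SV-unfold : ∀ {n} → SV (suc (suc n)) ↔ ((Fin 3 × SV (suc n)) ⊎ Fin 4)
SV-unfold {n} = mk↔ₛ′ to from to-from from-to
  where
  to : SV (suc (suc n)) → (Fin 3 × SV (suc n)) ⊎ Fin 4
  to (cp i x) = inj₁ (i , x)
  to (hub i)  = inj₂ (suc i)
  to top      = inj₂ zero
  from : (Fin 3 × SV (suc n)) ⊎ Fin 4 → SV (suc (suc n))
  from (inj₁ (i , x)) = cp i x
  from (inj₂ zero)    = top
  from (inj₂ (suc i)) = hub i
  to-from : ∀ y → to (from y) ≡ y
  to-from (inj₁ _)       = refl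
  to-from (inj₂ zero)    = refl
  to-from (inj₂ (suc _)) = refl
  from-to : ∀ x → from (to x) ≡ x
  from-to (cp _ _) = refl
  from-to (hub _)  = refl
  from-to top      = refl

SV↔Fin : ∀ n → SV n ↔ Fin (∣S∣ n)
SV↔Fin zero = mk↔ₛ′ (λ ()) (λ ()) (λ ()) (λ ())
SV↔Fin (suc zero) =
  mk↔ₛ′ (λ _ → zero) (λ _ → root) (λ { zero → refl }) (λ { root → refl })
SV↔Fin (suc (suc n)) =
  ↔-trans SV-unfold
    (↔-trans ((↔-refl ×-cong SV↔Fin (suc n)) ⊎-cong ↔-refl)
      (↔-trans (↔-sym *↔× ⊎-cong ↔-refl) (↔-sym +↔⊎)))

encode : ∀ {n} → SV n → Fin (∣S∣ n)
encode {n} = Inverse.to (SV↔Fin n)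

decode : ∀ n → Fin (∣S∣ n) → SV n
decode n = Inverse.from (SV↔Fin n)

decode-encode : ∀ {n} (v : SV n) → decode n (encode v) ≡ v
decode-encode {n} = Inverse.strictlyInverseʳ (SV↔Fin n)

encode-injective : ∀ {n} {u v : SV n} → encode u ≡ encode v → u ≡ v
encode-injective {n} = Injection.injective (↔⇒↣ (SV↔Fin n))

decode-injective : ∀ n x y → decode n x ≡ decode n y → x ≡ y
decode-injective n x y = Injection.injective (↔⇒↣ (↔-sym (SV↔Fin n)))

S : ℕ → Graph
S n = record
  { size   = ∣S∣ n
  ; Adj    = λ x y → SAdj (decode n x) (decode n y)
  ; sym    = SAdj-sym
  ; irrefl = SAdj-irrefl
  }

S-inΓ : ∀ n → 1 ℕ.≤ n → InΓ (S n)
S-inΓ n 1≤n = n , 1≤n , decode n , decode-injective n , λ _ _ → mk⇔ id id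

record Decomposition {V : Set} (E : Rel V ℓ) : Set (Level.suc ℓ) where
  field
    last         : ℕ
    Bag          : Fin (suc last) → V → Set
    covering     : ∀ v → ∃ λ i → Bag i v
    edgeCovering : ∀ {u v} → E u v → ∃ λ i → Bag i u × Bag i v
    contiguous   : ∀ v {i j k} → i Fin.≤ j → j Fin.≤ k → Bag i v → Bag k v → Bag j v
open Decomposition

asDecomposition : ∀ {G} → PathDecomposition G → Decomposition (Adj G)
asDecomposition P = record
  { last         = len P
  ; Bag          = λ i v → v ∈ bag P i
  ; covering     = covers P
  ; edgeCovering = edges P _ _
  ; contiguous   = λ v → interval P v _ _ _
  }

pullback : {E : Rel V ℓ} {F : Rel W ℓ} (f : V → W) →
           (∀ {u v} → E u v → F (f u) (f v)) → Decomposition F → Decomposition E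
pullback f f-hom D = record
  { last         = last D
  ; Bag          = λ i v → Bag D i (f v)
  ; covering     = covering D ∘ f
  ; edgeCovering = edgeCovering D ∘ f-hom
  ; contiguous   = contiguous D ∘ f
  }

data Walk (E : Rel V ℓ) (P : V → Set) : V → V → Set ℓ where
  end  : ∀ {v} → P v → Walk E P v v
  step : ∀ {u v w} → P u → E u v → Walk E P v w → Walk E P u w

-- If the edge u–v lies in a bag after r, then u lies in bags on both sides of r.
walk-meets-bag : {E : Rel V ℓ} {P : V → Set} (D : Decomposition E) {u w : V} →
                 Walk E P u w → ∀ {p q r} → Bag D p u → Bag D q w →
                 p Fin.≤ r → r Fin.≤ q → ∃ λ z → P z × Bag D r z
walk-meets-bag D (end {v} Pv) u∈p w∈q p≤r r≤q = v , Pv , contiguous D v p≤r r≤q u∈p w∈q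
walk-meets-bag D (step {u} Pu u~v walk) {r = r} u∈p w∈q p≤r r≤q
  with edgeCovering D u~v
... | s , u∈s , v∈s with ≤-total s r
...   | inj₁ s≤r = walk-meets-bag D walk v∈s w∈q s≤r r≤q
...   | inj₂ r≤s = u , Pu , contiguous D u p≤r r≤s u∈p u∈s

Apart : Rel V ℓ → Rel V ℓ
Apart E x y = x ≢ y × ¬ E x y

record IndependentBag {E : Rel V ℓ} (D : Decomposition E) (k : ℕ) : Set ℓ where
  field
    node        : Fin (suc (last D))
    members     : List V
    count       : length members ≡ k
    inBag       : All (Bag D node) members
    independent : AllPairs (Apart E) members
open IndependentBag

nonempty-bag : {E : Rel V ℓ} {D : Decomposition E} {k : ℕ} →
               (I : IndependentBag D (suc k)) → ∃ (Bag D (node I))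
nonempty-bag record { members = [] ; count = () }
nonempty-bag record { members = v ∷ _ ; inBag = v∈ ∷ _ } = v , v∈

median : {A : Set} {_≤_ : Rel A ℓ} → Total _≤_ → (x : Fin 3 → A) →
         ∃[ j ] (∃[ i ] i ≢ j × x i ≤ x j) × (∃[ l ] l ≢ j × x j ≤ x l)
median total x with total (x 0F) (x 1F) | total (x 1F) (x 2F) | total (x 0F) (x 2F)
... | inj₁ 0≤1 | inj₁ 1≤2 | _        = 1F , (0F , (λ ()) , 0≤1) , (2F , (λ ()) , 1≤2)
... | inj₁ 0≤1 | inj₂ 2≤1 | inj₁ 0≤2 = 2F , (0F , (λ ()) , 0≤2) , (1F , (λ ()) , 2≤1)
... | inj₁ 0≤1 | inj₂ 2≤1 | inj₂ 2≤0 = 0F , (2F , (λ ()) , 2≤0) , (1F , (λ ()) , 0≤1)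
... | inj₂ 1≤0 | _        | inj₁ 0≤2 = 0F , (1F , (λ ()) , 1≤0) , (2F , (λ ()) , 0≤2)
... | inj₂ 1≤0 | inj₁ 1≤2 | inj₂ 2≤0 = 2F , (1F , (λ ()) , 1≤2) , (0F , (λ ()) , 2≤0)
... | inj₂ 1≤0 | inj₂ 2≤1 | inj₂ _   = 1F , (2F , (λ ()) , 2≤1) , (0F , (λ ()) , 1≤0)

fromList : ∀ {k} → List (Fin k) → Subset k
fromList []       = Subset.⊥
fromList (x ∷ xs) = ⁅ x ⁆ ∪ fromList xs

∈-fromList⁻ : ∀ {k} {y : Fin k} xs → y ∈ fromList xs → y ∈ₗ xs
∈-fromList⁻ []       y∈ = ⊥-elim (∉⊥ y∈)
∈-fromList⁻ (x ∷ xs) y∈ with x∈p∪q⁻ ⁅ x ⁆ (fromList xs) y∈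
... | inj₁ y∈⁅x⁆ = here (x∈⁅y⁆⇒x≡y x y∈⁅x⁆)
... | inj₂ y∈xs  = there (∈-fromList⁻ xs y∈xs)

fromList-⊆ : ∀ {k} {B : Subset k} {xs} → All (_∈ B) xs → fromList xs ⊆ B
fromList-⊆ []                    y∈ = ⊥-elim (∉⊥ y∈)
fromList-⊆ {xs = x ∷ xs} (x∈B ∷ xs⊆B) y∈ with x∈p∪q⁻ ⁅ x ⁆ (fromList xs) y∈
... | inj₁ y∈⁅x⁆ rewrite x∈⁅y⁆⇒x≡y x y∈⁅x⁆ = x∈B
... | inj₂ y∈xs  = fromList-⊆ xs⊆B y∈xs

length≤∣fromList∣ : ∀ {k} {xs : List (Fin k)} → Unique xs → length xs ℕ.≤ ∣ fromList xs ∣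
length≤∣fromList∣ []                          = z≤n
length≤∣fromList∣ {xs = x ∷ xs} (x∉xs ∷ uniq) =
  ≤-trans (s≤s (length≤∣fromList∣ uniq))
    (p⊂q⇒∣p∣<∣q∣ (q⊆p∪q _ _ , x , x∈p∪q⁺ (inj₁ (x∈⁅x⁆ x)) , x∉))
  where
  x∉ : x ∉ fromList xs
  x∉ x∈ = All.lookup x∉xs (∈-fromList⁻ xs x∈) refl

apart-members-nonadjacent : (G : Graph) {xs : List (Fin (size G))} →
                            AllPairs (Apart (Adj G)) xs →
                            ∀ {x y} → x ∈ₗ xs → y ∈ₗ xs → ¬ Adj G x y
apart-members-nonadjacent G _           (here refl) (here refl) = irrefl G
apart-members-nonadjacent G (px ∷ _)    (here refl) (there y∈)  = proj₂ (All.lookup px y∈)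
apart-members-nonadjacent G (px ∷ _)    (there x∈)  (here refl) =
  proj₂ (All.lookup px x∈) ∘ Graph.sym G
apart-members-nonadjacent G (_ ∷ apart) (there x∈)  (there y∈)  =
  apart-members-nonadjacent G apart x∈ y∈

apart-length≤ : (G : Graph) {B : Subset (size G)} {c : ℕ} → αInduced≤ G B c →
                {xs : List (Fin (size G))} → All (_∈ B) xs →
                AllPairs (Apart (Adj G)) xs → length xs ℕ.≤ c
apart-length≤ G α≤c {xs} xs⊆B apart =
  ≤-trans (length≤∣fromList∣ (AllPairs.map proj₁ apart))
    (α≤c (fromList xs) (fromList-⊆ xs⊆B) λ x y x∈ y∈ →
      apart-members-nonadjacent G apart (∈-fromList⁻ xs x∈) (∈-fromList⁻ xs y∈))

copy : ∀ {n} → Fin 3 → Decomposition (SAdj {suc (suc n)}) → Decomposition (SAdj {suc n})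
copy i = pullback (cp i) (refl ,_)

FarFrom : ∀ {n} → Fin 3 → SV (suc (suc n)) → Set
FarFrom j z = ∀ t → Apart SAdj z (cp j t)

copies-joined : ∀ {n} {i j l : Fin 3} → i ≢ j → l ≢ j → (a b : SV (suc n)) →
                Walk SAdj (FarFrom j) (cp i a) (cp l b)
copies-joined i≢j l≢j a b =
  step (far-cp i≢j a) refl (step (far-hub i≢j) tt (step far-top tt
    (step (far-hub l≢j) refl (end (far-cp l≢j b)))))
  where
  far-cp : ∀ {k j} → k ≢ j → ∀ c → FarFrom j (cp k c)
  far-cp k≢j c t = (λ { refl → k≢j refl }) , k≢j ∘ proj₁
  far-hub : ∀ {k j n} → k ≢ j → FarFrom {n} j (hub k)
  far-hub k≢j t = (λ ()) , k≢j
  far-top : ∀ {j n} → FarFrom {n} j top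
  far-top t = (λ ()) , λ ()

extend : ∀ {n k} {D : Decomposition (SAdj {suc (suc n)})} {j : Fin 3}
         (I : IndependentBag (copy j D) k) {z : SV (suc (suc n))} →
         FarFrom j z → Bag D (node I) z → IndependentBag D (suc k)
extend {j = j} I {z} far z∈ = record
  { node        = node I
  ; members     = z ∷ map (cp j) (members I)
  ; count       = cong suc (trans (length-map (cp j) (members I)) (count I))
  ; inBag       = z∈ ∷ All.map⁺ (inBag I)
  ; independent = All.map⁺ (All.tabulate λ {t} _ → far t)
                ∷ AllPairs.map⁺ (AllPairs.map cp-apart (independent I))
  }
  where
  cp-apart : ∀ {u v} → Apart SAdj u v → Apart SAdj (cp j u) (cp j v)
  cp-apart (u≢v , u≁v) = (λ { refl → u≢v refl }) , u≁v ∘ proj₂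

independent-bag : ∀ m (D : Decomposition (SAdj {suc m})) → IndependentBag D (suc m)
independent-bag zero D = record
  { node = proj₁ (covering D root) ; members = root ∷ [] ; count = refl
  ; inBag = proj₂ (covering D root) ∷ [] ; independent = [] ∷ [] }
independent-bag (suc m) D = through-median (median ≤-total (node ∘ I))
  where
  I : ∀ k → IndependentBag (copy k D) (suc m)
  I k = independent-bag m (copy k D)
  through-median : ∃[ j ] (∃[ i ] i ≢ j × node (I i) Fin.≤ node (I j))
                          × (∃[ l ] l ≢ j × node (I j) Fin.≤ node (I l)) →
                   IndependentBag D (suc (suc m))
  through-median (j , (i , i≢j , i≤j) , (l , l≢j , j≤l))
    with nonempty-bag (I i) | nonempty-bag (I l)
  ... | a , a∈ | b , b∈ with walk-meets-bag D (copies-joined i≢j l≢j a b) a∈ b∈ i≤j j≤l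
  ...   | z , far , z∈ = extend (I j) far z∈

S-¬αpw≤ : ∀ c → ¬ αpw≤ (S (suc c)) c
S-¬αpw≤ c (P , α≤c) = n≮n c (≤-trans (≤-reflexive (≡.sym length≡)) bound)
  where
  n : ℕ
  n = suc c
  encode-adj : ∀ {u v : SV n} → SAdj u v → Adj (S n) (encode u) (encode v)
  encode-adj {u} {v} = subst₂ SAdj (≡.sym (decode-encode u)) (≡.sym (decode-encode v))
  encode-apart : ∀ {u v : SV n} → Apart SAdj u v → Apart (Adj (S n)) (encode u) (encode v)
  encode-apart {u} {v} (u≢v , u≁v) =
    u≢v ∘ encode-injective , u≁v ∘ subst₂ SAdj (decode-encode u) (decode-encode v)
  I : IndependentBag (pullback encode encode-adj (asDecomposition P)) n
  I = independent-bag c _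
  length≡ : length (map encode (members I)) ≡ n
  length≡ = trans (length-map encode (members I)) (count I)
  bound : length (map encode (members I)) ℕ.≤ c
  bound = apart-length≤ (S n) (α≤c (node I)) (All.map⁺ (inBag I))
            (AllPairs.map⁺ (AllPairs.map encode-apart (independent I)))

corollary4p3 : (c : ℕ) → Σ Graph λ G → InΓ G × ¬ αpw≤ G c
corollary4p3 c = S (suc c) , S-inΓ (suc c) (s≤s z≤n) , S-¬αpw≤ c
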